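{- For any integer $n\geq 1$, $$\Phi(D_n)=\left\lfloor\frac{n}{2}\right\rfloor \left\lceil\frac{n}{2}\right\rceil.$$
   Context: $D_n$ denotes the path graph (chain) on $n$ vertices $0,1,\dots,n-1$, with $a$ and $b$ adjacent iff $|a-b|=1$. For a connected graph $G$, a path system of $G$ is a set consisting of one chosen path in $G$ connecting $a$ and $b$ for each unordered pair $\{a,b\}$ of distinct vertices (for $D_n$ this path system is unique). A global packing of $(G,\mathcal{P})$ is a map $\omega:\mathcal{P}\to\{1,\dots,k\}$ such that $\omega(P)\neq\omega(P')$ whenever distinct paths $P,P'\in\mathcal{P}$ share at least one edge; $\Phi(G,\mathcal{P})$ is the minimum such $k$, and $\Phi(G)$ is the minimum of $\Phi(G,\mathcal{P})$ over all path systems of $G$. -}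

module Defs where

open import Data.Nat using (ℕ; _≤_; _<_; ⌊_/2⌋; ⌈_/2⌉)
open import Data.Fin using (Fin; toℕ)
open import Data.Product using (∃; _×_; Σ)
open import Relation.Binary.PropositionalEquality using (_≡_)
open import Relation.Nullary using (¬_)

-- The chain D_n: vertices Fin n; edge number i joins vertices i and i+1
-- (0 ≤ i, i+1 < n).  Between vertices a < b there is exactly one path,
-- namely a, a+1, ..., b, whose edges are exactly the edges i with a ≤ i < b.
-- The unique path system of D_n therefore has one path per pair a < b.

record Path (n : ℕ) : Set where
  constructor path
  field
    start  : Fin n
    end    : Fin n
    start<end : toℕ start < toℕ end
open Path public

_usesEdge_ : ∀ {n} → Path n → ℕ → Set
P usesEdge i = toℕ (start P) ≤ i × i < toℕ (end P)

ShareEdge : ∀ {n} → Path n → Path n → Set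
ShareEdge P Q = ∃ λ i → P usesEdge i × Q usesEdge i

IsGlobalPacking : (n k : ℕ) → (Path n → Fin k) → Set
IsGlobalPacking n k ω =
  ∀ (P Q : Path n) → ¬ (P ≡ Q) → ShareEdge P Q → ¬ (ω P ≡ ω Q)

ΦChainIs : ℕ → ℕ → Set
ΦChainIs n m =
  (Σ (Path n → Fin m) (IsGlobalPacking n m))
  × (∀ k (ω : Path n → Fin k) → IsGlobalPacking n k ω → m ≤ k)

module Submission where

open import Defs
open import Data.Nat
  using (ℕ; zero; suc; pred; _+_; _*_; _∸_; _≤_; _<_; _<?_; z≤n; s≤s; ⌊_/2⌋; ⌈_/2⌉)
open import Data.Nat.Properties hiding (_≟_)
open import Data.Fin using (Fin; toℕ; fromℕ<; _↑ˡ_; _↑ʳ_; combine; remQuot; _≟_)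
open import Data.Fin.Properties
  using (toℕ<n; toℕ-injective; fromℕ<-injective; toℕ-↑ˡ; toℕ-↑ʳ; ↑ˡ-injective; ↑ʳ-injective;
         combine-injective; combine-remQuot; injective⇒≤)
open import Data.Product using (_×_; _,_; proj₁; proj₂; uncurry; swap; map)
open import Data.Product.Properties using (×-≡,≡→≡; ,-injective; ,-injectiveˡ; ,-injectiveʳ)
open import Data.Empty using (⊥; ⊥-elim)
open import Function using (_∘_)
open import Function.Definitions using (Injective)
open import Relation.Binary.PropositionalEquality
open import Relation.Nullary using (yes; no)

-- Write n = h + r with h = ⌊n/2⌋ and r = ⌈n/2⌉, splitting the chain into a left
-- half of h vertices and a right half of r vertices.  The h * r paths from the
-- left half to the right half all use the middle edge, so they need pairwise
-- distinct colours.  Conversely, colour (u , v) with u < h, v < r can be shared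
-- by the consecutive, hence edge-disjoint, paths v → u → h + v → h + v + u + 1
-- (those of them that exist).  Every path arises in exactly one way, and
-- r ≤ h + 1 guarantees u < h for a path lying in the right half.

data Side (h a b : ℕ) : Set where
  left  : b < h → Side h a b
  cross : a < h → h ≤ b → Side h a b
  right : h ≤ a → Side h a b

side : ∀ h a b → Side h a b
side h a b with b <? h | a <? h
... | yes b<h | _       = left b<h
... | no  b≮h | yes a<h = cross a<h (≮⇒≥ b≮h)
... | no  _   | no  a≮h = right (≮⇒≥ a≮h)

colour : ∀ {h a b} → Side h a b → ℕ × ℕ
colour {h} {a} {b} (left _)    = b , a
colour {h} {a} {b} (cross _ _) = a , b ∸ h
colour {h} {a} {b} (right _)   = b ∸ suc a , a ∸ h

empty-interval : ∀ {lo hi i} → hi ≤ lo → lo ≤ i → i < hi → ⊥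
empty-interval hi≤lo lo≤i i<hi = <-irrefl refl (≤-trans i<hi (≤-trans hi≤lo lo≤i))

colour-injective : ∀ {h a b a′ b′ i} (s : Side h a b) (s′ : Side h a′ b′) →
                   a < b → a′ < b′ → a ≤ i × i < b → a′ ≤ i × i < b′ →
                   colour s ≡ colour s′ → a ≡ a′ × b ≡ b′
colour-injective (left _) (left _) _ _ _ _ eq = swap (,-injective eq)
colour-injective (left _) (cross _ _) _ _ (_ , i<b) (a′≤i , _) eq =
  ⊥-elim (empty-interval (≤-reflexive (,-injectiveˡ eq)) a′≤i i<b)
colour-injective (left b<h) (right h≤a′) _ _ (_ , i<b) (a′≤i , _) _ =
  ⊥-elim (empty-interval (≤-trans (<⇒≤ b<h) h≤a′) a′≤i i<b)
colour-injective (cross _ _) (left _) _ _ (a≤i , _) (_ , i<b′) eq =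
  ⊥-elim (empty-interval (≤-reflexive (sym (,-injectiveˡ eq))) a≤i i<b′)
colour-injective (cross _ h≤b) (cross _ h≤b′) _ _ _ _ eq =
  ,-injectiveˡ eq , ∸-cancelʳ-≡ h≤b h≤b′ (,-injectiveʳ eq)
colour-injective (cross _ h≤b) (right h≤a′) _ _ (_ , i<b) (a′≤i , _) eq =
  ⊥-elim (empty-interval (≤-reflexive (∸-cancelʳ-≡ h≤b h≤a′ (,-injectiveʳ eq))) a′≤i i<b)
colour-injective (right h≤a) (left b′<h) _ _ (a≤i , _) (_ , i<b′) _ =
  ⊥-elim (empty-interval (≤-trans (<⇒≤ b′<h) h≤a) a≤i i<b′)
colour-injective (right h≤a) (cross _ h≤b′) _ _ (a≤i , _) (_ , i<b′) eq =
  ⊥-elim (empty-interval (≤-reflexive (∸-cancelʳ-≡ h≤b′ h≤a (sym (,-injectiveʳ eq)))) a≤i i<b′)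
colour-injective (right h≤a) (right h≤a′) a<b a′<b′ _ _ eq
  with refl ← ∸-cancelʳ-≡ h≤a h≤a′ (,-injectiveʳ eq)
  = refl , ∸-cancelʳ-≡ a<b a′<b′ (,-injectiveˡ eq)

m∸n<o : ∀ {m n o} → n ≤ m → m < n + o → m ∸ n < o
m∸n<o {m} {n} {o} n≤m m<n+o = subst (m ∸ n <_) (m+n∸m≡n n o) (∸-monoˡ-< m<n+o n≤m)

colour-bounded : ∀ {h r a b} → h ≤ r → r ≤ suc h → (s : Side h a b) → a < b → b < h + r →
                 proj₁ (colour s) < h × proj₂ (colour s) < r
colour-bounded h≤r _ (left b<h) a<b _ = b<h , <-≤-trans (<-trans a<b b<h) h≤r
colour-bounded _ _ (cross a<h h≤b) _ b<h+r = a<h , m∸n<o h≤b b<h+r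
colour-bounded {h} {r} {a} {b} _ r≤1+h (right h≤a) a<b b<h+r =
  m∸n<o a<b b<1+a+h , m∸n<o h≤a (<-trans a<b b<h+r)
  where
  open ≤-Reasoning
  b<1+a+h : b < suc a + h
  b<1+a+h = begin-strict
    b        <⟨ b<h+r ⟩
    h + r    ≤⟨ +-monoʳ-≤ h (≤-trans r≤1+h (s≤s h≤a)) ⟩
    h + suc a ≡⟨ +-comm h (suc a) ⟩
    suc a + h ∎

Path-≡ : ∀ {n} {P Q : Path n} → start P ≡ start Q → end P ≡ end Q → P ≡ Q
Path-≡ {P = path s e s<e} {path _ _ s<e′} refl refl = cong (path s e) (<-irrelevant s<e s<e′)

clique⇒≤colours : ∀ {m n k i} (f : Fin m → Path n) → Injective _≡_ _≡_ f →
                  (∀ j → f j usesEdge i) → (ω : Path n → Fin k) → IsGlobalPacking n k ω → m ≤ k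
clique⇒≤colours {i = i} f f-injective f∋i ω ω-packing = injective⇒≤ ω∘f-injective
  where
  ω∘f-injective : Injective _≡_ _≡_ (ω ∘ f)
  ω∘f-injective {j} {j′} ωfj≡ωfj′ with j ≟ j′
  ... | yes j≡j′ = j≡j′
  ... | no j≢j′ = ⊥-elim (ω-packing (f j) (f j′) (j≢j′ ∘ f-injective) (i , f∋i j , f∋i j′) ωfj≡ωfj′)

crossing-start<end : ∀ {h r} (x : Fin h) (y : Fin r) → toℕ (x ↑ˡ r) < toℕ (h ↑ʳ y)
crossing-start<end {h} {r} x y = begin-strict
  toℕ (x ↑ˡ r)  ≡⟨ toℕ-↑ˡ x r ⟩
  toℕ x         <⟨ toℕ<n x ⟩
  h             ≤⟨ m≤m+n h (toℕ y) ⟩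
  h + toℕ y     ≡⟨ toℕ-↑ʳ h y ⟨
  toℕ (h ↑ʳ y)  ∎
  where open ≤-Reasoning

crossing : ∀ {h r} → Fin h → Fin r → Path (h + r)
crossing {h} {r} x y = path (x ↑ˡ r) (h ↑ʳ y) (crossing-start<end x y)

crossing-injective : ∀ {h r} {x x′ : Fin h} {y y′ : Fin r} →
                     crossing x y ≡ crossing x′ y′ → (x , y) ≡ (x′ , y′)
crossing-injective {h} {r} {x} {x′} {y} {y′} eq =
  ×-≡,≡→≡ (↑ˡ-injective r x x′ (cong start eq) , ↑ʳ-injective h y y′ (cong end eq))

crossing-uses-middle : ∀ {h r} (x : Fin h) (y : Fin r) → crossing x y usesEdge pred h
crossing-uses-middle {suc h} {r} x y =
  subst (_≤ h) (sym (toℕ-↑ˡ x r)) (<⇒≤pred (toℕ<n x)) ,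
  subst (h <_) (sym (toℕ-↑ʳ (suc h) y)) (s≤s (m≤m+n h (toℕ y)))

crossingPath : ∀ {h r} → Fin (h * r) → Path (h + r)
crossingPath {h} {r} = uncurry crossing ∘ remQuot r

crossingPath-injective : ∀ {h r} → Injective _≡_ _≡_ (crossingPath {h} {r})
crossingPath-injective {h} {r} {k} {l} eq = begin
  k                                ≡⟨ combine-remQuot {h} r k ⟨
  uncurry combine (remQuot {h} r k) ≡⟨ cong (uncurry combine) (crossing-injective eq) ⟩
  uncurry combine (remQuot {h} r l) ≡⟨ combine-remQuot {h} r l ⟩
  l                                ∎
  where open ≡-Reasoning

h*r≤colours : ∀ {h r} k (ω : Path (h + r) → Fin k) → IsGlobalPacking (h + r) k ω → h * r ≤ k
h*r≤colours {h} {r} _ = clique⇒≤colours (crossingPath {h} {r}) crossingPath-injective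
  (λ j → crossing-uses-middle (proj₁ (remQuot {h} r j)) (proj₂ (remQuot {h} r j)))

module _ {h r : ℕ} (h≤r : h ≤ r) (r≤1+h : r ≤ suc h) where

  pathSide : (P : Path (h + r)) → Side h (toℕ (start P)) (toℕ (end P))
  pathSide P = side h _ _

  pathColour-bounded : (P : Path (h + r)) →
                       proj₁ (colour (pathSide P)) < h × proj₂ (colour (pathSide P)) < r
  pathColour-bounded P = colour-bounded h≤r r≤1+h (pathSide P) (start<end P) (toℕ<n (end P))

  packing : Path (h + r) → Fin (h * r)
  packing P = combine (fromℕ< (proj₁ (pathColour-bounded P))) (fromℕ< (proj₂ (pathColour-bounded P)))

  packing-isGlobal : IsGlobalPacking (h + r) (h * r) packing
  packing-isGlobal P Q P≢Q (i , P∋i , Q∋i) packingP≡packingQ =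
    P≢Q (Path-≡ (toℕ-injective (proj₁ same-ends)) (toℕ-injective (proj₂ same-ends)))
    where
    same-colour : colour (pathSide P) ≡ colour (pathSide Q)
    same-colour = ×-≡,≡→≡ (map (fromℕ<-injective _ _ _ _) (fromℕ<-injective _ _ _ _)
                                (combine-injective {h} {r} _ _ _ _ packingP≡packingQ))
    same-ends : toℕ (start P) ≡ toℕ (start Q) × toℕ (end P) ≡ toℕ (end Q)
    same-ends = colour-injective (pathSide P) (pathSide Q) (start<end P) (start<end Q) P∋i Q∋i same-colour

Φ-balanced-chain : ∀ {h r} → h ≤ r → r ≤ suc h → ΦChainIs (h + r) (h * r)
Φ-balanced-chain {h} {r} h≤r r≤1+h =
  (packing h≤r r≤1+h , packing-isGlobal h≤r r≤1+h) , h*r≤colours {h} {r}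

⌈n/2⌉≤1+⌊n/2⌋ : ∀ n → ⌈ n /2⌉ ≤ suc ⌊ n /2⌋
⌈n/2⌉≤1+⌊n/2⌋ zero          = z≤n
⌈n/2⌉≤1+⌊n/2⌋ (suc zero)    = s≤s z≤n
⌈n/2⌉≤1+⌊n/2⌋ (suc (suc n)) = s≤s (⌈n/2⌉≤1+⌊n/2⌋ n)

theorem3 : ∀ (n : ℕ) → 1 ≤ n → ΦChainIs n (⌊ n /2⌋ * ⌈ n /2⌉)
theorem3 n _ = subst (λ m → ΦChainIs m (⌊ n /2⌋ * ⌈ n /2⌉)) (⌊n/2⌋+⌈n/2⌉≡n n)
                 (Φ-balanced-chain (⌊n/2⌋≤⌈n/2⌉ n) (⌈n/2⌉≤1+⌊n/2⌋ n))
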